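{- Let $(X,R)$ be the 3-cyclic forcing network and let $G$ be a connected $X$-colored graph that is color-contracted (no two adjacent vertices have the same color) and in which each of the colors $1,2,3$ appears at least once. Consider the forcing process with propagation. (1) If each vertex colored $3$ has a neighbor $v$ colored $2$ all of whose neighbors are colored $3$, then $\epsilon(\ell_0(G))$ has all vertices colored $1$. (2) If each vertex colored $2$ has a neighbor colored $1$, then $\epsilon(\ell_0(G))$ has all vertices colored $3$. (3) If each vertex colored $1$ has a neighbor $v$ colored $3$ all of whose neighbors are colored $1$, and the hypothesis of (2) does not hold, then $\epsilon(\ell_0(G))$ has all vertices colored $2$.
   Context: The 3-cyclic forcing network is $X=\{1,2,3\}$ with the ordered list of rules $R=(1\to 2,\,2\to 3,\,3\to 1)$. An $X$-colored graph is a finite simple graph with each vertex colored by an element of $X$. Applying a rule $a\to b$ in a forcing step means simultaneously recoloring with $a$ every vertex of color $b$ having a neighbor of color $a$; a propagating forcing step with rule $a\to b$ repeats forcing steps with that rule until no vertex of color $b$ has a neighbor of color $a$. The process with propagation applies propagating forcing steps with the rules in cyclic order $1\to2,2\to3,3\to1,1\to2,\dots$ until no rule can be applied; $\ell_0(G)$ is the initial coloring and $\epsilon(\ell_0(G))$ the final coloring (end state). -}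

module Defs where

open import Data.Nat using (ℕ)
open import Data.Fin using (Fin)
open import Data.Bool using (Bool; true; false; _∧_; _∨_; if_then_else_)
open import Data.List using (List; allFin)
open import Data.Bool.ListAction using (any)
open import Data.Product using (Σ; ∃; _×_)
open import Relation.Binary.PropositionalEquality using (_≡_; _≢_)
open import Relation.Nullary using (¬_)

data Color : Set where
  c1 c2 c3 : Color

_==ᶜ_ : Color → Color → Bool
c1 ==ᶜ c1 = true
c2 ==ᶜ c2 = true
c3 ==ᶜ c3 = true
_  ==ᶜ _  = false

-- The 3-cyclic forcing network: the rules are  a → next a,
-- i.e. 1→2, 2→3, 3→1, applied in cyclic order starting from 1→2.
-- A rule is identified by its source color a; its target is next a.
next : Color → Color
next c1 = c2
next c2 = c3
next c3 = c1

record Graph (n : ℕ) : Set where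
  field
    adj    : Fin n → Fin n → Bool
    sym    : ∀ u v → adj u v ≡ adj v u
    irrefl : ∀ v → adj v v ≡ false

open Graph public

Adj : {n : ℕ} → Graph n → Fin n → Fin n → Set
Adj G u v = adj G u v ≡ true

data Reachable {n : ℕ} (G : Graph n) : Fin n → Fin n → Set where
  here : ∀ {v} → Reachable G v v
  step : ∀ {u w v} → Adj G u w → Reachable G w v → Reachable G u v

Connected : {n : ℕ} → Graph n → Set
Connected {n} G = ∀ (u v : Fin n) → Reachable G u v

Coloring : ℕ → Set
Coloring n = Fin n → Color

hasNbr : {n : ℕ} → Graph n → Coloring n → Color → Fin n → Bool
hasNbr {n} G ℓ a v = any (λ w → adj G v w ∧ (ℓ w ==ᶜ a)) (allFin n)

canApply : {n : ℕ} → Graph n → Color → Color → Coloring n → Bool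
canApply {n} G a b ℓ = any (λ v → (ℓ v ==ᶜ b) ∧ hasNbr G ℓ a v) (allFin n)

forceStep : {n : ℕ} → Graph n → Color → Color → Coloring n → Coloring n
forceStep G a b ℓ v = if (ℓ v ==ᶜ b) ∧ hasNbr G ℓ a v then a else ℓ v

data Propagate {n : ℕ} (G : Graph n) (a b : Color) : Coloring n → Coloring n → Set where
  done : ∀ {ℓ} → canApply G a b ℓ ≡ false → Propagate G a b ℓ ℓ
  more : ∀ {ℓ ℓ'} → canApply G a b ℓ ≡ true →
         Propagate G a b (forceStep G a b ℓ) ℓ' → Propagate G a b ℓ ℓ'

anyRule : {n : ℕ} → Graph n → Coloring n → Bool
anyRule G ℓ = canApply G c1 c2 ℓ ∨ canApply G c2 c3 ℓ ∨ canApply G c3 c1 ℓ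

-- Process with propagation, current rule (next to be applied) a → next a.
data Run {n : ℕ} (G : Graph n) : Color → Coloring n → Coloring n → Set where
  stop : ∀ {a ℓ} → anyRule G ℓ ≡ false → Run G a ℓ ℓ
  go   : ∀ {a ℓ ℓ₁ ℓ'} → anyRule G ℓ ≡ true →
         Propagate G a (next a) ℓ ℓ₁ → Run G (next a) ℓ₁ ℓ' → Run G a ℓ ℓ'

-- ℓ' is the end state ε(ℓ₀) of the process started at ℓ₀ with rule 1 → 2.
-- (Run is deterministic, so this characterises the unique end state.)
EndState : {n : ℕ} → Graph n → Coloring n → Coloring n → Set
EndState G ℓ₀ ℓ' = Run G c1 ℓ₀ ℓ'

EndsAllColored : {n : ℕ} → Graph n → Coloring n → Color → Set
EndsAllColored {n} G ℓ₀ c = Σ (Coloring n) (λ ℓ' → EndState G ℓ₀ ℓ' × (∀ v → ℓ' v ≡ c))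

ColorContracted : {n : ℕ} → Graph n → Coloring n → Set
ColorContracted G ℓ = ∀ u v → Adj G u v → ℓ u ≢ ℓ v

AllColorsAppear : {n : ℕ} → Coloring n → Set
AllColorsAppear {n} ℓ = ∀ (c : Color) → ∃ (λ (v : Fin n) → ℓ v ≡ c)

PendantCond : {n : ℕ} → Graph n → Coloring n → Color → Color → Set
PendantCond {n} G ℓ b a = ∀ (v : Fin n) → ℓ v ≡ b →
  ∃ (λ w → Adj G v w × ℓ w ≡ a × (∀ x → Adj G w x → ℓ x ≡ b))

NbrCond : {n : ℕ} → Graph n → Coloring n → Color → Color → Set
NbrCond {n} G ℓ b a = ∀ (v : Fin n) → ℓ v ≡ b → ∃ (λ w → Adj G v w × ℓ w ≡ a)

module Submission where

-- A propagating step with rule a → b never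
-- recolors a vertex of color a, and it terminates because every forcing step shrinks the set
-- of vertices of color b. In (2) the step 1 → 2 therefore erases color 2. In (1) the pendant
-- 2-vertices survive 1 → 2 (their neighbors are all 3) and then erase color 3 under 2 → 3.
-- In (3), since (2) fails, some 2-vertex has no 1-neighbor, so all its neighbors are 3 and it
-- keeps color 2 throughout; the pendant 3-vertices survive 1 → 2 and 2 → 3 and then, under
-- 3 → 1, recolor every original 1-vertex and hence every vertex that 1 → 2 had turned into 1,
-- so color 1 vanishes. Once a color c has vanished the rule c → next c is idle, and on the
-- connected two-colored graph left over the rule next c → next (next c) floods everything
-- with next c. Should the process stop earlier, no edge joins two colors, so the coloring is
-- already constant.

open import Defs hiding (sym)
open import Data.Nat using (ℕ)
open import Data.Fin using (Fin)
open import Data.Fin.Properties using (¬∀⟶∃¬)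
open import Data.Fin.Subset using (Subset; _∈_; _⊂_)
open import Data.Fin.Subset.Induction using (⊂-wellFounded)
open import Data.Bool using (Bool; true; false; _∧_; _∨_; if_then_else_)
import Data.Bool as Bool
open import Data.Bool.Properties using (T-≡; ∧-conicalˡ; ∧-conicalʳ; ∨-conicalˡ; ∨-conicalʳ; ¬-not)
open import Data.Bool.ListAction using (any)
open import Data.List using (allFin)
open import Data.List.Membership.Propositional using (lose)
open import Data.List.Membership.Propositional.Properties using (∈-allFin)
open import Data.List.Relation.Unary.Any using (satisfied)
open import Data.List.Relation.Unary.Any.Properties using (any⁺; any⁻)
open import Data.Vec using (tabulate)
open import Data.Vec.Properties using ([]=⇒lookup; lookup⇒[]=; lookup∘tabulate)
open import Data.Product using (∃; _×_; _,_; proj₁)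
import Data.Product as Product
open import Data.Sum using (_⊎_; inj₁; inj₂)
import Data.Sum as Sum
open import Function.Base using (_∘_)
open import Function.Bundles using (Equivalence)
open import Induction.WellFounded using (Acc; acc)
open import Relation.Binary.PropositionalEquality
open import Relation.Nullary using (¬_; Dec; yes; no; contradiction)
open import Relation.Nullary.Decidable using (map′; _→-dec_)

private
  variable
    a b c x y : Color

==ᶜ-sound : (x ==ᶜ y) ≡ true → x ≡ y
==ᶜ-sound {c1} {c1} _ = refl
==ᶜ-sound {c2} {c2} _ = refl
==ᶜ-sound {c3} {c3} _ = refl

==ᶜ-complete : x ≡ y → (x ==ᶜ y) ≡ true
==ᶜ-complete {c1} refl = refl
==ᶜ-complete {c2} refl = refl
==ᶜ-complete {c3} refl = refl

_≟ᶜ_ : (x y : Color) → Dec (x ≡ y)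
x ≟ᶜ y = map′ ==ᶜ-sound ==ᶜ-complete ((x ==ᶜ y) Bool.≟ true)

next-≢ : ∀ c → c ≢ next c
next-≢ c1 ()
next-≢ c2 ()
next-≢ c3 ()

≢⇒next-or-next² : x ≢ c → x ≡ next c ⊎ x ≡ next (next c)
≢⇒next-or-next² {c1} {c1} x≢c = contradiction refl x≢c
≢⇒next-or-next² {c2} {c2} x≢c = contradiction refl x≢c
≢⇒next-or-next² {c3} {c3} x≢c = contradiction refl x≢c
≢⇒next-or-next² {c1} {c2} _ = inj₂ refl
≢⇒next-or-next² {c1} {c3} _ = inj₁ refl
≢⇒next-or-next² {c2} {c1} _ = inj₁ refl
≢⇒next-or-next² {c2} {c3} _ = inj₂ refl
≢⇒next-or-next² {c3} {c1} _ = inj₂ refl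
≢⇒next-or-next² {c3} {c2} _ = inj₁ refl

distinct⇒rule : x ≢ y → next x ≡ y ⊎ next y ≡ x
distinct⇒rule {c1} {c1} x≢y = contradiction refl x≢y
distinct⇒rule {c2} {c2} x≢y = contradiction refl x≢y
distinct⇒rule {c3} {c3} x≢y = contradiction refl x≢y
distinct⇒rule {c1} {c2} _ = inj₁ refl
distinct⇒rule {c1} {c3} _ = inj₂ refl
distinct⇒rule {c2} {c1} _ = inj₂ refl
distinct⇒rule {c2} {c3} _ = inj₁ refl
distinct⇒rule {c3} {c1} _ = inj₁ refl
distinct⇒rule {c3} {c2} _ = inj₂ refl

any-allFin⁻ : ∀ {n} (p : Fin n → Bool) → any p (allFin n) ≡ true → ∃ λ v → p v ≡ true
any-allFin⁻ {n} p e =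
  Product.map₂ (Equivalence.to T-≡) (satisfied (any⁻ p (allFin n) (Equivalence.from T-≡ e)))

any-allFin⁺ : ∀ {n} (p : Fin n → Bool) {v} → p v ≡ true → any p (allFin n) ≡ true
any-allFin⁺ {n} p {v} e =
  Equivalence.to T-≡ (any⁺ {xs = allFin n} p (lose (∈-allFin v) (Equivalence.from T-≡ e)))

∧-true⁻ : ∀ {s t} → s ∧ t ≡ true → s ≡ true × t ≡ true
∧-true⁻ e = ∧-conicalˡ _ _ e , ∧-conicalʳ _ _ e

module _ {n : ℕ} (G : Graph n) where

  private
    variable
      ℓ ℓ' ℓ₁ : Coloring n
      u v w : Fin n

  adj-sym : Adj G u v → Adj G v u
  adj-sym {u} {v} uv = trans (Graph.sym G v u) uv

  hasNbr-sound : hasNbr G ℓ a v ≡ true → ∃ λ w → Adj G v w × ℓ w ≡ a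
  hasNbr-sound e = Product.map₂ (Product.map₂ ==ᶜ-sound ∘ ∧-true⁻) (any-allFin⁻ {n} _ e)

  hasNbr-complete : Adj G v w → ℓ w ≡ a → hasNbr G ℓ a v ≡ true
  hasNbr-complete vw wa = any-allFin⁺ {n} _ (cong₂ _∧_ vw (==ᶜ-complete wa))

  canApply-sound : canApply G a b ℓ ≡ true → ∃ λ v → ℓ v ≡ b × hasNbr G ℓ a v ≡ true
  canApply-sound e = Product.map₂ (Product.map₁ ==ᶜ-sound ∘ ∧-true⁻) (any-allFin⁻ {n} _ e)

  canApply-complete : ℓ v ≡ b → Adj G v w → ℓ w ≡ a → canApply G a b ℓ ≡ true
  canApply-complete vb vw wa =
    any-allFin⁺ {n} _ (cong₂ _∧_ (==ᶜ-complete vb) (hasNbr-complete vw wa))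

  canApply-false : (∀ v w → ℓ v ≡ b → Adj G v w → ℓ w ≢ a) → canApply G a b ℓ ≡ false
  canApply-false never = ¬-not λ e →
    let v , vb , h = canApply-sound e
        w , vw , wa = hasNbr-sound h
    in never v w vb vw wa

  stuck-edge : canApply G a b ℓ ≡ false → ℓ v ≡ b → Adj G v w → ℓ w ≢ a
  stuck-edge stuck vb vw wa with () ← trans (sym (canApply-complete vb vw wa)) stuck

  neighbor? : ∀ ℓ a v → Dec (∃ λ w → Adj G v w × ℓ w ≡ a)
  neighbor? ℓ a v =
    map′ hasNbr-sound (λ (_ , vw , wa) → hasNbr-complete vw wa) (hasNbr G ℓ a v Bool.≟ true)

  forceStep-cases : ∀ ℓ v → forceStep G a b ℓ v ≡ ℓ v
                        ⊎ (ℓ v ≡ b × hasNbr G ℓ a v ≡ true × forceStep G a b ℓ v ≡ a)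
  forceStep-cases {a} {b} ℓ v with (ℓ v ==ᶜ b) ∧ hasNbr G ℓ a v in e
  ... | false = inj₁ refl
  ... | true  = let vb , h = ∧-true⁻ e in inj₂ (==ᶜ-sound vb , h , refl)

  forceStep-fires : ℓ v ≡ b → hasNbr G ℓ a v ≡ true → forceStep G a b ℓ v ≡ a
  forceStep-fires vb h = cong₂ (λ s t → if s ∧ t then _ else _) (==ᶜ-complete vb) h

  forceStep-keeps : ℓ v ≢ b → forceStep G a b ℓ v ≡ ℓ v
  forceStep-keeps {ℓ} {v} v≢b with forceStep-cases ℓ v
  ... | inj₁ same = same
  ... | inj₂ (vb , _) = contradiction vb v≢b

  forceStep-idle : (∀ w → Adj G v w → ℓ w ≢ a) → forceStep G a b ℓ v ≡ ℓ v
  forceStep-idle {v} {ℓ} no-source with forceStep-cases ℓ v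
  ... | inj₁ same = same
  ... | inj₂ (_ , h , _) = let w , vw , wa = hasNbr-sound h in contradiction wa (no-source w vw)

  Forced : Color → Color → Coloring n → Coloring n → Set
  Forced a b ℓ ℓ' = ∀ v → ℓ' v ≡ ℓ v ⊎ (ℓ v ≡ b × ℓ' v ≡ a × ∃ λ w → Adj G v w × ℓ' w ≡ a)

  Forced-keeps : Forced a b ℓ ℓ' → ℓ v ≡ c → c ≢ b → ℓ' v ≡ c
  Forced-keeps {v = v} f vc c≢b with f v
  ... | inj₁ same = trans same vc
  ... | inj₂ (vb , _) = contradiction (trans (sym vc) vb) c≢b

  Forced-reflects : Forced a b ℓ ℓ' → ℓ' v ≡ c → c ≢ a → ℓ v ≡ c
  Forced-reflects {v = v} f vc c≢a with f v
  ... | inj₁ same = trans (sym same) vc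
  ... | inj₂ (_ , va , _) = contradiction (trans (sym vc) va) c≢a

  Forced-trans : a ≢ b → Forced a b ℓ ℓ₁ → Forced a b ℓ₁ ℓ' → Forced a b ℓ ℓ'
  Forced-trans a≢b f g v with f v | g v
  ... | inj₁ same₁ | inj₁ same₂ = inj₁ (trans same₂ same₁)
  ... | inj₁ same₁ | inj₂ (vb , rest) = inj₂ (trans (sym same₁) vb , rest)
  ... | inj₂ (vb , va , w , vw , wa) | inj₁ same₂ =
    inj₂ (vb , trans same₂ va , w , vw , Forced-keeps g wa a≢b)
  ... | inj₂ (_ , va , _) | inj₂ (vb , _) = contradiction (trans (sym va) vb) a≢b

  forceStep-Forced : a ≢ b → Forced a b ℓ (forceStep G a b ℓ)
  forceStep-Forced {a} {b} {ℓ} a≢b v with forceStep-cases ℓ v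
  ... | inj₁ same = inj₁ same
  ... | inj₂ (vb , h , va) =
    let w , vw , wa = hasNbr-sound h
        w-kept = forceStep-keeps {ℓ = ℓ} {a = a} (subst (_≢ _) (sym wa) a≢b)
    in inj₂ (vb , va , w , vw , trans w-kept wa)

  Forced-near-source : ColorContracted G ℓ → Forced a b ℓ ℓ' → ℓ' v ≡ a →
                       ℓ v ≡ a ⊎ ∃ λ w → Adj G v w × ℓ w ≡ a
  Forced-near-source {v = v} cc f va with f v
  ... | inj₁ same = inj₁ (trans (sym same) va)
  ... | inj₂ (vb , _ , w , vw , wa) with f w
  ...   | inj₁ same = inj₂ (w , vw , trans (sym same) wa)
  ...   | inj₂ (wb , _) = contradiction (trans vb (sym wb)) (cc v w vw)

  Star : Coloring n → Fin n → Color → Color → Set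
  Star ℓ w x y = ℓ w ≡ x × (∀ u → Adj G w u → ℓ u ≡ y)

  forceStep-preserves-Star : y ≢ a → y ≢ b → Star ℓ w x y → Star (forceStep G a b ℓ) w x y
  forceStep-preserves-Star {a = a} {b} {ℓ} y≢a y≢b (wx , nbrs) =
    trans (forceStep-idle {ℓ = ℓ} {b = b} λ u wu → subst (_≢ _) (sym (nbrs u wu)) y≢a) wx ,
    λ u wu → trans (forceStep-keeps {ℓ = ℓ} {a = a} (subst (_≢ _) (sym (nbrs u wu)) y≢b))
                   (nbrs u wu)

  colorClass : Color → Coloring n → Subset n
  colorClass b ℓ = tabulate (λ v → ℓ v ==ᶜ b)

  ∈-colorClass⁻ : v ∈ colorClass b ℓ → ℓ v ≡ b
  ∈-colorClass⁻ {v = v} v∈ = ==ᶜ-sound (trans (sym (lookup∘tabulate _ v)) ([]=⇒lookup v∈))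

  ∈-colorClass⁺ : ℓ v ≡ b → v ∈ colorClass b ℓ
  ∈-colorClass⁺ {v = v} vb = lookup⇒[]= v _ (trans (lookup∘tabulate _ v) (==ᶜ-complete vb))

  forceStep-shrinks : a ≢ b → canApply G a b ℓ ≡ true →
                      colorClass b (forceStep G a b ℓ) ⊂ colorClass b ℓ
  forceStep-shrinks {a} {b} {ℓ} a≢b e =
    let v , vb , h = canApply-sound e
        f = forceStep-Forced {ℓ = ℓ} a≢b
    in (λ v∈ → ∈-colorClass⁺ (Forced-reflects f (∈-colorClass⁻ v∈) (≢-sym a≢b)))
       , v , ∈-colorClass⁺ vb
       , λ v∈ → a≢b (trans (sym (forceStep-fires {ℓ = ℓ} vb h)) (∈-colorClass⁻ v∈))

  propagate : a ≢ b → ∀ ℓ → ∃ (Propagate G a b ℓ)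
  propagate {a} {b} a≢b ℓ = loop ℓ (⊂-wellFounded (colorClass b ℓ))
    where
    loop : ∀ ℓ → Acc _⊂_ (colorClass b ℓ) → ∃ (Propagate G a b ℓ)
    loop ℓ (acc smaller) with canApply G a b ℓ in e
    ... | false = ℓ , done e
    ... | true  =
      Product.map₂ (more e) (loop (forceStep G a b ℓ) (smaller (forceStep-shrinks a≢b e)))

  Propagate⇒stuck : Propagate G a b ℓ ℓ' → canApply G a b ℓ' ≡ false
  Propagate⇒stuck (done stuck) = stuck
  Propagate⇒stuck (more _ p)   = Propagate⇒stuck p

  Propagate⇒Forced : a ≢ b → Propagate G a b ℓ ℓ' → Forced a b ℓ ℓ'
  Propagate⇒Forced a≢b (done _)   _ = inj₁ refl
  Propagate⇒Forced a≢b (more _ p)   =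
    Forced-trans a≢b (forceStep-Forced a≢b) (Propagate⇒Forced a≢b p)

  Propagate-preserves-Star : y ≢ a → y ≢ b → Propagate G a b ℓ ℓ' → Star ℓ w x y → Star ℓ' w x y
  Propagate-preserves-Star y≢a y≢b (done _)   star = star
  Propagate-preserves-Star y≢a y≢b (more _ p) star =
    Propagate-preserves-Star y≢a y≢b p (forceStep-preserves-Star y≢a y≢b star)

  Propagate-forces : a ≢ b → Propagate G a b ℓ ℓ' → ℓ v ≡ b → Adj G v w → ℓ w ≡ a → ℓ' v ≡ a
  Propagate-forces {v = v} a≢b p vb vw wa with Propagate⇒Forced a≢b p v
  ... | inj₂ (_ , va , _) = va
  ... | inj₁ same = contradiction (Forced-keeps (Propagate⇒Forced a≢b p) wa a≢b)
                                  (stuck-edge (Propagate⇒stuck p) (trans same vb) vw)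

  Propagate-clears : a ≢ b → Propagate G a b ℓ ℓ' → NbrCond G ℓ b a → ∀ v → ℓ' v ≢ b
  Propagate-clears a≢b p nbr v vb with Forced-reflects (Propagate⇒Forced a≢b p) vb (≢-sym a≢b)
  ... | vb₀ with nbr v vb₀
  ...   | w , vw , wa = a≢b (trans (sym (Propagate-forces a≢b p vb₀ vw wa)) vb)

  lonely-vertex : ¬ NbrCond G ℓ b a → ∃ λ z → ℓ z ≡ b × (∀ w → Adj G z w → ℓ w ≢ a)
  lonely-vertex {ℓ} {b} {a} ¬nbr with ¬∀⟶∃¬ n _ (λ v → ℓ v ≟ᶜ b →-dec neighbor? ℓ a v) ¬nbr
  ... | z , ¬z-nbr with ℓ z ≟ᶜ b
  ...   | yes zb  = z , zb , λ w zw wa → ¬z-nbr λ _ → w , zw , wa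
  ...   | no z≢b = contradiction (λ zb → contradiction zb z≢b) ¬z-nbr

  stuck-spreads : canApply G a b ℓ ≡ false → (∀ v → ℓ v ≡ a ⊎ ℓ v ≡ b) →
                  ℓ u ≡ a → Reachable G u v → ℓ v ≡ a
  stuck-spreads stuck two ua here = ua
  stuck-spreads stuck two ua (step {w = w} uw walk) with two w
  ... | inj₁ wa = stuck-spreads stuck two wa walk
  ... | inj₂ wb = contradiction ua (stuck-edge stuck wb (adj-sym uw))

  stuck-monochrome : a ≢ b → (∀ v → ℓ v ≡ c) → canApply G a b ℓ ≡ false
  stuck-monochrome a≢b mono = canApply-false λ v w vb _ wa →
    a≢b (trans (sym wa) (trans (mono w) (trans (sym (mono v)) vb)))

  anyRule-false⇒stuck : anyRule G ℓ ≡ false → ∀ a → canApply G a (next a) ℓ ≡ false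
  anyRule-false⇒stuck idle c1 = ∨-conicalˡ _ _ idle
  anyRule-false⇒stuck {ℓ} idle c2 = ∨-conicalˡ _ _ (∨-conicalʳ (canApply G c1 c2 ℓ) _ idle)
  anyRule-false⇒stuck {ℓ} idle c3 = ∨-conicalʳ _ _ (∨-conicalʳ (canApply G c1 c2 ℓ) _ idle)

  stuck⇒anyRule-false : (∀ a → canApply G a (next a) ℓ ≡ false) → anyRule G ℓ ≡ false
  stuck⇒anyRule-false stuck = cong₂ _∨_ (stuck c1) (cong₂ _∨_ (stuck c2) (stuck c3))

  anyRule-false⇒edge-monochrome : anyRule G ℓ ≡ false → Adj G u w → ℓ u ≡ ℓ w
  anyRule-false⇒edge-monochrome {ℓ} {u} {w} idle uw with ℓ u ≟ᶜ ℓ w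
  ... | yes same = same
  ... | no differ with distinct⇒rule differ
  ...   | inj₁ u→w =
    contradiction refl (stuck-edge (anyRule-false⇒stuck idle (ℓ u)) (sym u→w) (adj-sym uw))
  ...   | inj₂ w→u =
    contradiction refl (stuck-edge (anyRule-false⇒stuck idle (ℓ w)) (sym w→u) uw)

  anyRule-false⇒walk-monochrome : anyRule G ℓ ≡ false → Reachable G u v → ℓ u ≡ ℓ v
  anyRule-false⇒walk-monochrome idle here          = refl
  anyRule-false⇒walk-monochrome idle (step uw walk) =
    trans (anyRule-false⇒edge-monochrome idle uw) (anyRule-false⇒walk-monochrome idle walk)

  module _ (conn : Connected G) where

    Propagate-floods : a ≢ b → Propagate G a b ℓ ℓ' → (∀ v → ℓ v ≡ a ⊎ ℓ v ≡ b) →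
                       ℓ u ≡ a → ∀ v → ℓ' v ≡ a
    Propagate-floods {u = u} a≢b p two ua v =
      stuck-spreads (Propagate⇒stuck p) two′ (Forced-keeps f ua a≢b) (conn u v)
      where
      f = Propagate⇒Forced a≢b p
      two′ : ∀ v → _ ≡ _ ⊎ _ ≡ _
      two′ v with f v
      ... | inj₁ same         = Sum.map (trans same) (trans same) (two v)
      ... | inj₂ (_ , va , _) = inj₁ va

    EndsFrom : Color → Coloring n → Color → Set
    EndsFrom a ℓ c = ∃ λ ℓ' → Run G a ℓ ℓ' × ∀ v → ℓ' v ≡ c

    ends-now : (∀ v → ℓ v ≡ c) → EndsFrom a ℓ c
    ends-now mono = _ , stop (stuck⇒anyRule-false λ a → stuck-monochrome (next-≢ a) mono) , mono

    ends-step : (∃ λ u → ℓ u ≡ c) → Propagate G a (next a) ℓ ℓ₁ → EndsFrom (next a) ℓ₁ c →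
                EndsFrom a ℓ c
    ends-step {ℓ} (u , uc) p (ℓ' , run , mono) with anyRule G ℓ in e
    ... | true  = ℓ' , go e p run , mono
    ... | false = ℓ , stop e , λ v → trans (sym (anyRule-false⇒walk-monochrome e (conn u v))) uc

    ends-after-vanishing : (∀ v → ℓ v ≢ c) → (∃ λ u → ℓ u ≡ next c) → EndsFrom c ℓ (next c)
    ends-after-vanishing {ℓ} {c} absent (u , uc) with propagate (next-≢ (next c)) ℓ
    ... | ℓ' , p = ends-step (u , uc) (done idle) (ends-step (u , uc) p (ends-now flooded))
      where
      idle = canApply-false λ _ w _ _ wc → absent w wc
      flooded = Propagate-floods (next-≢ (next c)) p (λ v → ≢⇒next-or-next² (absent v)) uc

    pendants-c3c2⇒ends-c1 : ∀ {ℓ₀} → (∃ λ u → ℓ₀ u ≡ c1) → PendantCond G ℓ₀ c3 c2 →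
                            EndsFrom c1 ℓ₀ c1
    pendants-c3c2⇒ends-c1 {ℓ₀} (u , u₀) pendants with propagate {c1} {c2} (λ ()) ℓ₀
    ... | ℓ₁ , p₁ with propagate {c2} {c3} (λ ()) ℓ₁
    ... | ℓ₂ , p₂ =
      ends-step (u , u₀) p₁ (ends-step (u , u₁) p₂ (ends-after-vanishing no-c3 (u , u₂)))
      where
      f₁ : Forced c1 c2 ℓ₀ ℓ₁
      f₁ = Propagate⇒Forced (λ ()) p₁
      u₁ = Forced-keeps f₁ u₀ λ ()
      u₂ = Forced-keeps (Propagate⇒Forced (λ ()) p₂) u₁ λ ()
      c3-next-to-c2 : NbrCond G ℓ₁ c3 c2
      c3-next-to-c2 v v₃ with pendants v (Forced-reflects f₁ v₃ λ ())
      ... | w , vw , star = w , vw , proj₁ (Propagate-preserves-Star (λ ()) (λ ()) p₁ star)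
      no-c3 = Propagate-clears (λ ()) p₂ c3-next-to-c2

    nbrs-c2c1⇒ends-c3 : ∀ {ℓ₀} → (∃ λ t → ℓ₀ t ≡ c3) → NbrCond G ℓ₀ c2 c1 → EndsFrom c1 ℓ₀ c3
    nbrs-c2c1⇒ends-c3 {ℓ₀} (t , t₀) nbrs with propagate {c1} {c2} (λ ()) ℓ₀
    ... | ℓ₁ , p₁ =
      ends-step (t , t₀) p₁ (ends-after-vanishing (Propagate-clears (λ ()) p₁ nbrs) (t , t₁))
      where
      t₁ = Forced-keeps (Propagate⇒Forced (λ ()) p₁) t₀ λ ()

    pendants-c1c3⇒ends-c2 : ∀ {ℓ₀} → ColorContracted G ℓ₀ → PendantCond G ℓ₀ c1 c3 →
                            ¬ NbrCond G ℓ₀ c2 c1 → EndsFrom c1 ℓ₀ c2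
    pendants-c1c3⇒ends-c2 {ℓ₀} cc pendants ¬nbrs
      with lonely-vertex ¬nbrs | propagate {c1} {c2} (λ ()) ℓ₀
    ... | z , z₀ , lonely | ℓ₁ , p₁ with propagate {c2} {c3} (λ ()) ℓ₁
    ... | ℓ₂ , p₂ with propagate {c3} {c1} (λ ()) ℓ₂
    ... | ℓ₃ , p₃ = ends-step (z , z₀) p₁ (ends-step (z , z₁) p₂ (ends-step (z , z₂) p₃
                      (ends-after-vanishing no-c1 (z , z₃))))
      where
      f₁ : Forced c1 c2 ℓ₀ ℓ₁
      f₁ = Propagate⇒Forced (λ ()) p₁
      f₂ : Forced c2 c3 ℓ₁ ℓ₂
      f₂ = Propagate⇒Forced (λ ()) p₂
      f₃ : Forced c3 c1 ℓ₂ ℓ₃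
      f₃ = Propagate⇒Forced (λ ()) p₃

      z-nbrs : ∀ x → Adj G z x → ℓ₀ x ≡ c3
      z-nbrs x zx with ≢⇒next-or-next² (lonely x zx)
      ... | inj₁ x₂ = contradiction (trans z₀ (sym x₂)) (cc z x zx)
      ... | inj₂ x₃ = x₃
      z₁ = proj₁ (Propagate-preserves-Star (λ ()) (λ ()) p₁ (z₀ , z-nbrs))
      z₂ = Forced-keeps f₂ z₁ λ ()
      z₃ = Forced-keeps f₃ z₂ λ ()

      c1-becomes-c3 : ∀ v → ℓ₀ v ≡ c1 → ℓ₃ v ≡ c3
      c1-becomes-c3 v v₀ with pendants v v₀
      ... | w , vw , w₀ , w-nbrs = Propagate-forces (λ ()) p₃ v₂ vw (proj₁ star₂)
        where
        v₂ = Forced-keeps f₂ (Forced-keeps f₁ v₀ λ ()) λ ()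
        star₂ = Propagate-preserves-Star (λ ()) (λ ()) p₂
                  (Forced-keeps f₁ w₀ (λ ()) , λ x wx → Forced-keeps f₁ (w-nbrs x wx) λ ())

      -- A 1-vertex of ℓ₃ was already 1 in ℓ₁, so it was an original 1-vertex or next to one.
      no-c1 : ∀ v → ℓ₃ v ≢ c1
      no-c1 v v₃
        with Forced-near-source cc f₁ (Forced-reflects f₂ (Forced-reflects f₃ v₃ λ ()) λ ())
      ... | inj₁ v₀ with () ← trans (sym (c1-becomes-c3 v v₀)) v₃
      ... | inj₂ (w , vw , w₀) = stuck-edge (Propagate⇒stuck p₃) v₃ vw (c1-becomes-c3 w w₀)

lemma4p5 : ∀ (n : ℕ) (G : Graph n) (ℓ₀ : Coloring n) →
    Connected G → ColorContracted G ℓ₀ → AllColorsAppear ℓ₀ →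
      ((PendantCond G ℓ₀ c3 c2 → EndsAllColored G ℓ₀ c1)
      × (NbrCond G ℓ₀ c2 c1 → EndsAllColored G ℓ₀ c3)
      × (PendantCond G ℓ₀ c1 c3 → ¬ NbrCond G ℓ₀ c2 c1 → EndsAllColored G ℓ₀ c2))
lemma4p5 n G ℓ₀ conn cc ac =
  pendants-c3c2⇒ends-c1 G conn (ac c1) ,
  nbrs-c2c1⇒ends-c3 G conn (ac c3) ,
  pendants-c1c3⇒ends-c2 G conn cc
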